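{- (Subject reduction.) If $\Gamma\vdash A$ is derivable and $A\to B$ is a one-step reduction of $\lambda\alpha$, then $\Gamma\vdash B$ is derivable.
   Context: Variables $x,y,z,\ldots$; $\mathsf{x},\mathsf{y},\mathsf{z}$ range over variables. Terms and substitutions of $\lambda\alpha$: $A,B::=\mathsf{x}\mid AB\mid\lambda\mathsf{x}.A\mid S\circ A$, $S::=[B/\mathsf{x}]\mid W\mathsf{x}\mid\{\mathsf{y}\mathsf{x}\}\mid S_{\mathsf{x}}$; $S_1\circ S_2\circ A$ means $S_1\circ(S_2\circ A)$, $S\circ AB$ means $S\circ(AB)$, $\lambda\mathsf{x}.S\circ A$ means $\lambda\mathsf{x}.(S\circ A)$. A context $\Gamma$ is a pair $G,L$ of a finite set $G$ of variables and a finite list $L$ of variables with repetitions allowed; $\mathsf{x}\in\Gamma$ means $\mathsf{x}\in G$ or $\mathsf{x}$ occurs in $L$; $\Gamma,\mathsf{x}$ denotes $G,(L,\mathsf{x})$; a context with empty list is written $G$. Derivable judgements: $G\vdash\mathsf{x}$ if $\mathsf{x}\in G$; $\Gamma,\mathsf{x}\vdash\mathsf{x}$; from $\Gamma\vdash\mathsf{x}$ infer $\Gamma,\mathsf{y}\vdash\mathsf{x}$ ($\mathsf{x}\neq\mathsf{y}$); from $\Gamma\vdash A$, $\Gamma\vdash B$ infer $\Gamma\vdash AB$; from $\Gamma,\mathsf{x}\vdash A$ infer $\Gamma\vdash\lambda\mathsf{x}.A$; from $\Gamma\vdash S\triangleright\Delta$, $\Delta\vdash A$ infer $\Gamma\vdash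 S\circ A$; from $\Gamma\vdash B$ infer $\Gamma\vdash[B/\mathsf{x}]\triangleright\Gamma,\mathsf{x}$; $\Gamma,\mathsf{x}\vdash W\mathsf{x}\triangleright\Gamma$; $\Gamma,\mathsf{y}\vdash\{\mathsf{y}\mathsf{x}\}\triangleright\Gamma,\mathsf{x}$; from $\Gamma\vdash S\triangleright\Delta$ infer $\Gamma,\mathsf{x}\vdash S_{\mathsf{x}}\triangleright\Delta,\mathsf{x}$. Free variables (partial): $FV(\mathsf{x})=\{\mathsf{x}\}$; $FV(AB)=FV(A)\sqcup FV(B)$; $FV(\lambda\mathsf{x}.A)=O_{\lambda\mathsf{x}}(FV(A))$; $FV(W\mathsf{x}\circ A)=FV(A),\mathsf{x}$; $FV([B/\mathsf{x}]\circ A)=FV((\lambda\mathsf{x}.A)B)$; $FV(\{\mathsf{y}\mathsf{x}\}\circ A)=FV(W\mathsf{y}\circ\lambda\mathsf{x}.A)$; $FV(S_{\mathsf{x}}\circ A)=FV(W\mathsf{x}\circ S\circ\lambda\mathsf{x}.A)$; where $O_{\lambda\mathsf{x}}(\Gamma,\mathsf{x})=\Gamma$, $O_{\lambda\mathsf{x}}(G)=G\setminus\{\mathsf{x}\}$, otherwise undefined; $(\Gamma,\mathsf{x})\sqcup(\Delta,\mathsf{x})=(\Gamma\sqcup\Delta),\mathsf{x}$, $(\Gamma,\mathsf{x})\sqcup G=(\Gamma\sqcup(G\setminus\{\mathsf{x}\})),\mathsf{x}$, $G\sqcup(\Gamma,\mathsf{x})=((G\setminus\{\mathsf{x}\})\sqcup\Gamma),\mathsf{x}$,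 $G_1\sqcup G_2=G_1\cup G_2$, otherwise undefined. One-step reduction of $\lambda\alpha$ is the closure under all constructors (under $\lambda\mathsf{x}.$, either side of application, either component of $S\circ A$, inside $B$ of $[B/\mathsf{x}]$, inside $S$ of $S_{\mathsf{x}}$) of: $(\lambda\mathsf{x}.A)B\to[B/\mathsf{x}]\circ A$; $S\circ AB\to(S\circ A)(S\circ B)$; $S\circ\lambda\mathsf{x}.A\to\lambda\mathsf{x}.S_{\mathsf{x}}\circ A$; $[B/\mathsf{x}]\circ\mathsf{x}\to B$; $[B/\mathsf{x}]\circ W\mathsf{x}\circ A\to A$; $[B/\mathsf{x}]\circ\mathsf{z}\to\mathsf{z}$ ($\mathsf{x}\neq\mathsf{z}$); $\{\mathsf{y}\mathsf{x}\}\circ\mathsf{x}\to\mathsf{y}$; $\{\mathsf{y}\mathsf{x}\}\circ W\mathsf{x}\circ A\to W\mathsf{y}\circ A$; $\{\mathsf{y}\mathsf{x}\}\circ\mathsf{z}\to W\mathsf{y}\circ\mathsf{z}$ ($\mathsf{x}\neq\mathsf{z}$); $S_{\mathsf{x}}\circ\mathsf{x}\to\mathsf{x}$; $S_{\mathsf{x}}\circ W\mathsf{x}\circ A\to W\mathsf{x}\circ S\circ A$; $S_{\mathsf{x}}\circ\mathsf{z}\to W\mathsf{x}\circ S\circ\mathsf{z}$ ($\mathsf{x}\neq\mathsf{z}$); $W\mathsf{x}\circ\mathsf{z}\to\mathsf{z}$ ($\mathsf{x}\neq\mathsf{z}$); $\lambda\mathsf{x}.A\to\lambda\mathsf{y}.\{\mathsf{y}\mathsf{x}\}\circ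 A$ provided $FV(\lambda\mathsf{x}.A)$ is defined, $\mathsf{x}\in FV(\lambda\mathsf{x}.A)$ and $\mathsf{y}\notin FV(\lambda\mathsf{x}.A)$. -}

module Defs where

open import Data.Nat using (ℕ; _≟_)
open import Data.List using (List; []; _∷_; filter; _++_)
open import Data.List.Membership.Propositional using (_∈_)
open import Data.Maybe using (Maybe; just; nothing; _>>=_; map)
open import Data.Sum using (_⊎_)
open import Relation.Binary.PropositionalEquality using (_≡_; _≢_)
open import Relation.Nullary using (¬_; yes; no)
open import Relation.Nullary.Decidable using (⌊_⌋)

Var : Set
Var = ℕ

mutual
  data Term : Set where
    var : Var → Term
    app : Term → Term → Term
    lam : Var → Term → Term
    _∘_ : Subst → Term → Term

  data Subst : Set where
    [_/_] : Term → Var → Subst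
    W     : Var → Subst
    ｛_,_｝ : Var → Var → Subst        -- {y x}  written ｛ y , x ｝
    _↑_   : Subst → Var → Subst      -- S_x    written S ↑ x

infixr 5 _∘_

-- A context G , L : a finite set G (represented by a list, read as a set)
-- and a finite list L of variables (repetitions allowed), built by snoc.
data Ctx : Set where
  ⟨_⟩ : List Var → Ctx
  _,_ : Ctx → Var → Ctx

infixl 4 _,_

_∈ᶜ_ : Var → Ctx → Set
x ∈ᶜ ⟨ G ⟩ = x ∈ G
x ∈ᶜ (Γ , y) = x ∈ᶜ Γ ⊎ x ≡ y

mutual
  data _⊢_ : Ctx → Term → Set where
    ax-G   : ∀ {G x} → x ∈ G → ⟨ G ⟩ ⊢ var x
    ax-L   : ∀ {Γ x} → (Γ , x) ⊢ var x
    weak   : ∀ {Γ x y} → Γ ⊢ var x → x ≢ y → (Γ , y) ⊢ var x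
    ⊢app   : ∀ {Γ A B} → Γ ⊢ A → Γ ⊢ B → Γ ⊢ app A B
    ⊢lam   : ∀ {Γ x A} → (Γ , x) ⊢ A → Γ ⊢ lam x A
    ⊢sub   : ∀ {Γ Δ S A} → Γ ⊢ S ▷ Δ → Δ ⊢ A → Γ ⊢ (S ∘ A)

  data _⊢_▷_ : Ctx → Subst → Ctx → Set where
    ⊢[/]   : ∀ {Γ B x} → Γ ⊢ B → Γ ⊢ [ B / x ] ▷ (Γ , x)
    ⊢W     : ∀ {Γ x} → (Γ , x) ⊢ W x ▷ Γ
    ⊢swap  : ∀ {Γ x y} → (Γ , y) ⊢ ｛ y , x ｝ ▷ (Γ , x)
    ⊢lift  : ∀ {Γ Δ S x} → Γ ⊢ S ▷ Δ → (Γ , x) ⊢ (S ↑ x) ▷ (Δ , x)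

remove : Var → List Var → List Var
remove x G = filter (λ z → ¬? (z ≟ x)) G
  where open import Relation.Nullary.Decidable using (¬?)

O : Var → Ctx → Maybe Ctx
O x ⟨ G ⟩ = just ⟨ remove x G ⟩
O x (Γ , y) with y ≟ x
... | yes _ = just Γ
... | no  _ = nothing

_⊔ᴳ_ : Ctx → List Var → Ctx
⟨ G₁ ⟩ ⊔ᴳ G₂ = ⟨ G₁ ++ G₂ ⟩
(Γ , x) ⊔ᴳ G = (Γ ⊔ᴳ remove x G) , x

_ᴳ⊔_ : List Var → Ctx → Ctx
G₁ ᴳ⊔ ⟨ G₂ ⟩ = ⟨ G₁ ++ G₂ ⟩
G ᴳ⊔ (Γ , x) = (remove x G ᴳ⊔ Γ) , x

_⊔_ : Ctx → Ctx → Maybe Ctx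
⟨ G ⟩ ⊔ Δ = just (G ᴳ⊔ Δ)
(Γ , x) ⊔ ⟨ G ⟩ = just ((Γ , x) ⊔ᴳ G)
(Γ , x) ⊔ (Δ , y) with x ≟ y
... | yes _ = map (_, x) (Γ ⊔ Δ)
... | no  _ = nothing

Oᵐ : Var → Maybe Ctx → Maybe Ctx
Oᵐ x m = m >>= O x

_⊔ᵐ_ : Maybe Ctx → Maybe Ctx → Maybe Ctx
m ⊔ᵐ n = m >>= λ Γ → n >>= λ Δ → Γ ⊔ Δ

snocᵐ : Maybe Ctx → Var → Maybe Ctx
snocᵐ m x = map (_, x) m

-- FV (S ∘ A) = fvS S (FV A), where fvS unfolds
-- the clauses:
--   FV(W x ∘ A)     = FV(A), x
--   FV([B/x] ∘ A)   = FV((λx.A)B)        = O_λx(FV A) ⊔ FV B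
--   FV({y x} ∘ A)   = FV(W y ∘ λx.A)     = O_λx(FV A), y
--   FV(S_x ∘ A)     = FV(W x ∘ S ∘ λx.A) = fvS S (O_λx(FV A)), x
mutual
  FV : Term → Maybe Ctx
  FV (var x)   = just ⟨ x ∷ [] ⟩
  FV (app A B) = FV A ⊔ᵐ FV B
  FV (lam x A) = Oᵐ x (FV A)
  FV (S ∘ A)   = fvS S (FV A)

  fvS : Subst → Maybe Ctx → Maybe Ctx
  fvS [ B / x ] m = Oᵐ x m ⊔ᵐ FV B
  fvS (W x) m = snocᵐ m x
  fvS ｛ y , x ｝ m = snocᵐ (Oᵐ x m) y
  fvS (S ↑ x) m = snocᵐ (fvS S (Oᵐ x m)) x

mutual
  data _⟶_ : Term → Term → Set where
    β        : ∀ {x A B} → app (lam x A) B ⟶ ([ B / x ] ∘ A)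
    σ-app    : ∀ {S A B} → (S ∘ app A B) ⟶ app (S ∘ A) (S ∘ B)
    σ-lam    : ∀ {S x A} → (S ∘ lam x A) ⟶ lam x ((S ↑ x) ∘ A)
    sub-var  : ∀ {B x} → ([ B / x ] ∘ var x) ⟶ B
    sub-W    : ∀ {B x A} → ([ B / x ] ∘ W x ∘ A) ⟶ A
    sub-z    : ∀ {B x z} → x ≢ z → ([ B / x ] ∘ var z) ⟶ var z
    swp-var  : ∀ {y x} → (｛ y , x ｝ ∘ var x) ⟶ var y
    swp-W    : ∀ {y x A} → (｛ y , x ｝ ∘ W x ∘ A) ⟶ (W y ∘ A)
    swp-z    : ∀ {y x z} → x ≢ z → (｛ y , x ｝ ∘ var z) ⟶ (W y ∘ var z)
    lift-var : ∀ {S x} → ((S ↑ x) ∘ var x) ⟶ var x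
    lift-W   : ∀ {S x A} → ((S ↑ x) ∘ W x ∘ A) ⟶ (W x ∘ S ∘ A)
    lift-z   : ∀ {S x z} → x ≢ z → ((S ↑ x) ∘ var z) ⟶ (W x ∘ S ∘ var z)
    W-z      : ∀ {x z} → x ≢ z → (W x ∘ var z) ⟶ var z
    α        : ∀ {x y A Γ} → FV (lam x A) ≡ just Γ → x ∈ᶜ Γ → ¬ (y ∈ᶜ Γ)
               → lam x A ⟶ lam y (｛ y , x ｝ ∘ A)
    c-lam    : ∀ {x A A'} → A ⟶ A' → lam x A ⟶ lam x A'
    c-appˡ   : ∀ {A A' B} → A ⟶ A' → app A B ⟶ app A' B
    c-appʳ   : ∀ {A B B'} → B ⟶ B' → app A B ⟶ app A B'
    c-subˢ   : ∀ {S S' A} → S ⟶ₛ S' → (S ∘ A) ⟶ (S' ∘ A)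
    c-subᵗ   : ∀ {S A A'} → A ⟶ A' → (S ∘ A) ⟶ (S ∘ A')

  data _⟶ₛ_ : Subst → Subst → Set where
    c-[/]    : ∀ {B B' x} → B ⟶ B' → [ B / x ] ⟶ₛ [ B' / x ]
    c-lift   : ∀ {S S' x} → S ⟶ₛ S' → (S ↑ x) ⟶ₛ (S' ↑ x)

infix 3 _⊢_ _⊢_▷_ _⟶_ _⟶ₛ_

module Submission where

-- Typing is syntax-directed, so every typing of a redex is
-- determined by its shape, and only two inversion principles are needed:
--   * a variable other than the last one of Γ , x is already typed in Γ
--     (the derivation must end with a weakening), and
--   * a term W x ∘ A typed in Γ , x has A typed in Γ (the substitution W x
--     erases exactly the last context entry).  Since reduction
-- also takes place inside substitutions, the induction is carried out
-- simultaneously for terms and for substitutions; the theorem is its term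
-- half.

open import Defs
open import Relation.Binary.PropositionalEquality using (refl; sym; _≢_)
open import Data.Empty using (⊥-elim)

-- A variable z different from the last entry x of Γ , x can only be typed by
-- weakening, hence it is already typed in Γ.
strengthen-var : ∀ {Γ x z} → (Γ , x) ⊢ var z → x ≢ z → Γ ⊢ var z
strengthen-var ax-L       x≢z = ⊥-elim (x≢z refl)
strengthen-var (weak d _) _   = d

-- W x discards the last entry x of its source context, so a term under W x
-- is typed in the context without x.
strengthen-W : ∀ {Γ x A} → (Γ , x) ⊢ W x ∘ A → Γ ⊢ A
strengthen-W (⊢sub ⊢W dA) = dA

mutual
  subject-reduction : ∀ {Γ A B} → Γ ⊢ A → A ⟶ B → Γ ⊢ B
  -- β and α: the body's context Γ , x is produced by [B/x] resp. {y x}.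
  subject-reduction (⊢app (⊢lam dA) dB) β         = ⊢sub (⊢[/] dB) dA
  subject-reduction (⊢lam dA)           (α _ _ _) = ⊢lam (⊢sub ⊢swap dA)
  subject-reduction (⊢sub dS (⊢app dA dB)) σ-app = ⊢app (⊢sub dS dA) (⊢sub dS dB)
  subject-reduction (⊢sub dS (⊢lam dA))    σ-lam = ⊢lam (⊢sub (⊢lift dS) dA)
  subject-reduction (⊢sub (⊢[/] dB) ax-L)         sub-var     = dB
  subject-reduction (⊢sub (⊢[/] _)  (weak _ x≢x)) sub-var     = ⊥-elim (x≢x refl)
  subject-reduction (⊢sub (⊢[/] _)  dA)           sub-W       = strengthen-W dA
  subject-reduction (⊢sub (⊢[/] _)  dz)           (sub-z x≢z) = strengthen-var dz x≢z
  subject-reduction (⊢sub ⊢swap ax-L)         swp-var     = ax-L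
  subject-reduction (⊢sub ⊢swap (weak _ x≢x)) swp-var     = ⊥-elim (x≢x refl)
  subject-reduction (⊢sub ⊢swap dA)           swp-W       = ⊢sub ⊢W (strengthen-W dA)
  subject-reduction (⊢sub ⊢swap dz)           (swp-z x≢z) = ⊢sub ⊢W (strengthen-var dz x≢z)
  subject-reduction (⊢sub (⊢lift _)  ax-L)         lift-var = ax-L
  subject-reduction (⊢sub (⊢lift _)  (weak _ x≢x)) lift-var = ⊥-elim (x≢x refl)
  subject-reduction (⊢sub (⊢lift dS) dA)           lift-W   = ⊢sub ⊢W (⊢sub dS (strengthen-W dA))
  subject-reduction (⊢sub (⊢lift dS) dz)           (lift-z x≢z) =
    ⊢sub ⊢W (⊢sub dS (strengthen-var dz x≢z))
  subject-reduction (⊢sub ⊢W dz) (W-z x≢z) = weak dz (λ z≡x → x≢z (sym z≡x))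
  subject-reduction (⊢lam dA)    (c-lam r)  = ⊢lam (subject-reduction dA r)
  subject-reduction (⊢app dA dB) (c-appˡ r) = ⊢app (subject-reduction dA r) dB
  subject-reduction (⊢app dA dB) (c-appʳ r) = ⊢app dA (subject-reduction dB r)
  subject-reduction (⊢sub dS dA) (c-subˢ r) = ⊢sub (subject-reductionₛ dS r) dA
  subject-reduction (⊢sub dS dA) (c-subᵗ r) = ⊢sub dS (subject-reduction dA r)

  subject-reductionₛ : ∀ {Γ Δ S S'} → Γ ⊢ S ▷ Δ → S ⟶ₛ S' → Γ ⊢ S' ▷ Δ
  subject-reductionₛ (⊢[/] dB)  (c-[/] r)  = ⊢[/] (subject-reduction dB r)
  subject-reductionₛ (⊢lift dS) (c-lift r) = ⊢lift (subject-reductionₛ dS r)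

mainTheorem5 : ∀ {Γ A B} → Γ ⊢ A → A ⟶ B → Γ ⊢ B
mainTheorem5 = subject-reduction
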